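{- Let $\gamma\in\mathcal{M}^0_{1,3}$. Then $E\gamma E(0)$ ends with $0$; writing $E\gamma E(0)=u'0$, the morphism $\Psi_{E\gamma E}$ with $u'\,\Psi_{E\gamma E}(a)=E\gamma E(a)\,u'$ for $a\in\{0,1\}$ exists and $$\Psi_{E\gamma E}=E\circ\widetilde{\Psi}_\gamma\circ E.$$ Moreover, if $\Psi_\gamma=\psi_{i_1}\circ\cdots\circ\psi_{i_m}$ with each $i_k\in\{3,8\}$, then $\Psi_{E\gamma E}=\psi_{i_1}^*\circ\cdots\circ\psi_{i_m}^*$, where $\psi_3^*=\psi_8$ and $\psi_8^*=\psi_3$.
   Context: Morphisms of $\{0,1\}^*$: $E: 0\mapsto1,\ 1\mapsto 0$; $\psi_1: 0\mapsto 01,\ 1\mapsto 0$; $\psi_3: 0\mapsto 0,\ 1\mapsto 01$; $\psi_8: 0\mapsto 01,\ 1\mapsto 1$. $\mathcal{M}_{1,3}$ is the monoid under composition generated by $\psi_1,\psi_3$, and $\mathcal{M}^0_{1,3}$ the set of $\gamma\in\mathcal{M}_{1,3}$ with $\gamma(0)$ ending in $0$. For such $\gamma$, writing $\gamma(0)=u0$, $\Psi_\gamma$ is the morphism conjugate to $\gamma$ by $u$: $u\,\Psi_\gamma(a)=\gamma(a)\,u$ for $a\in\{0,1\}$ (if $\gamma(1)=u0v$ then $\Psi_\gamma(0)=0u$, $\Psi_\gamma(1)=0vu$). The time reversal $\widetilde{\sigma}$ of a morphism $\sigma$ is the morphism sending each letter $a$ to the reversal of the word $\sigma(a)$. -}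

module Defs where

open import Data.List using (List; []; _∷_; _++_; concatMap; reverse; map; foldr)
open import Relation.Binary.PropositionalEquality using (_≡_)

data Letter : Set where
  𝟎 𝟏 : Letter

Word : Set
Word = List Letter

-- A morphism of {0,1}^* is determined by the images of the letters
Morphism : Set
Morphism = Letter → Word

apply : Morphism → Word → Word
apply σ w = concatMap σ w

_∘ₘ_ : Morphism → Morphism → Morphism
(σ ∘ₘ τ) a = apply σ (τ a)

idₘ : Morphism
idₘ a = a ∷ []

-- equality of morphisms (pointwise on letters, hence on all words)
_≈ₘ_ : Morphism → Morphism → Set
σ ≈ₘ τ = ∀ a → σ a ≡ τ a

E : Morphism
E 𝟎 = 𝟏 ∷ []
E 𝟏 = 𝟎 ∷ []

ψ₁ : Morphism
ψ₁ 𝟎 = 𝟎 ∷ 𝟏 ∷ []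
ψ₁ 𝟏 = 𝟎 ∷ []

ψ₃ : Morphism
ψ₃ 𝟎 = 𝟎 ∷ []
ψ₃ 𝟏 = 𝟎 ∷ 𝟏 ∷ []

ψ₈ : Morphism
ψ₈ 𝟎 = 𝟎 ∷ 𝟏 ∷ []
ψ₈ 𝟏 = 𝟏 ∷ []

reversal : Morphism → Morphism
reversal σ a = reverse (σ a)

-- elements of M_{1,3} are given by words over the generators ψ₁, ψ₃
data Gen13 : Set where
  g1 g3 : Gen13

gen13 : Gen13 → Morphism
gen13 g1 = ψ₁
gen13 g3 = ψ₃

eval13 : List Gen13 → Morphism
eval13 gs = foldr (λ g σ → gen13 g ∘ₘ σ) idₘ gs

data Gen38 : Set where
  i3 i8 : Gen38

gen38 : Gen38 → Morphism
gen38 i3 = ψ₃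
gen38 i8 = ψ₈

star : Gen38 → Gen38
star i3 = i8
star i8 = i3

eval38 : List Gen38 → Morphism
eval38 is = foldr (λ i σ → gen38 i ∘ₘ σ) idₘ is

IsConjugate : Word → Morphism → Morphism → Set
IsConjugate u γ Φ = ∀ a → u ++ Φ a ≡ γ a ++ u

module Submission where

-- Everything is phrased through conjugation of morphisms:
-- "v conjugates σ to τ" means v τ(a) = σ(a) v for every letter a (the
-- relation IsConjugate v σ τ of Defs).  This relation extends to words,
-- is compatible with composition and reversal, and can be cancelled.
--
-- (1) Every γ in M_{1,3} is "standard": γ(0) = u x and γ(1) = z x̄ for a
--     letter x, and z ũ conjugates γ to its time reversal γ̃.  This is
--     proved by induction on a word in the generators, using that ψ₁ and
--     ψ₃ satisfy ψ(a) 0 = 0 ψ̃(a).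
-- (2) If u conjugates γ to Ψ_γ, reversing gives that ũ conjugates Ψ̃_γ to
--     γ̃; cancelling ũ against z ũ shows that z conjugates γ to Ψ̃_γ.
--     Relabelling letters by E, the word E(z) conjugates EγE to EΨ̃_γE,
--     and γ(1) = z 1 gives EγE(0) = E(z) 0.
-- (3) The map σ ↦ σ* = E σ̃ E is multiplicative and exchanges ψ₃ and ψ₈,
--     so (ψ_{i₁} ∘ ⋯ ∘ ψ_{iₘ})* = ψ*_{i₁} ∘ ⋯ ∘ ψ*_{iₘ}.

open import Defs
open import Data.List using (List; []; _∷_; _++_; map; reverse; _∷ʳ_)
open import Data.List.Properties
  using (++-assoc; ++-identityʳ; concatMap-++; concatMap-cong; reverse-++; unfold-reverse; ∷ʳ-injective; ∷ʳ-++; ++-cancelʳ)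
open import Data.Product using (Σ; _×_; _,_)
open import Relation.Binary.PropositionalEquality using (_≡_; refl; sym; trans; cong; subst; module ≡-Reasoning)
open ≡-Reasoning

apply-++ : (σ : Morphism) (v w : Word) → apply σ (v ++ w) ≡ apply σ v ++ apply σ w
apply-++ = concatMap-++

apply-snoc : (σ : Morphism) (w : Word) (a : Letter) → apply σ (w ∷ʳ a) ≡ apply σ w ++ σ a
apply-snoc σ w a = trans (apply-++ σ w (a ∷ [])) (cong (apply σ w ++_) (++-identityʳ (σ a)))

apply-∘ : (σ τ : Morphism) (w : Word) → apply (σ ∘ₘ τ) w ≡ apply σ (apply τ w)
apply-∘ σ τ [] = refl
apply-∘ σ τ (a ∷ w) = begin
  apply σ (τ a) ++ apply (σ ∘ₘ τ) w     ≡⟨ cong (apply σ (τ a) ++_) (apply-∘ σ τ w) ⟩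
  apply σ (τ a) ++ apply σ (apply τ w)  ≡⟨ sym (apply-++ σ (τ a) (apply τ w)) ⟩
  apply σ (τ a ++ apply τ w)            ∎

reverse-apply : (σ : Morphism) (w : Word) → reverse (apply σ w) ≡ apply (reversal σ) (reverse w)
reverse-apply σ [] = refl
reverse-apply σ (a ∷ w) = begin
  reverse (σ a ++ apply σ w)                      ≡⟨ reverse-++ (σ a) (apply σ w) ⟩
  reverse (apply σ w) ++ reverse (σ a)            ≡⟨ cong (_++ reverse (σ a)) (reverse-apply σ w) ⟩
  apply (reversal σ) (reverse w) ++ reversal σ a  ≡⟨ sym (apply-snoc (reversal σ) (reverse w) a) ⟩
  apply (reversal σ) (reverse w ∷ʳ a)             ≡⟨ cong (apply (reversal σ)) (sym (unfold-reverse a w)) ⟩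
  apply (reversal σ) (reverse (a ∷ w))            ∎

reversal-∘ : (σ τ : Morphism) → reversal (σ ∘ₘ τ) ≈ₘ (reversal σ ∘ₘ reversal τ)
reversal-∘ σ τ a = reverse-apply σ (τ a)

E-involutive : (w : Word) → apply E (apply E w) ≡ w
E-involutive [] = refl
E-involutive (𝟎 ∷ w) = cong (𝟎 ∷_) (E-involutive w)
E-involutive (𝟏 ∷ w) = cong (𝟏 ∷_) (E-involutive w)


conjugate-resp : ∀ {v σ τ τ′} → IsConjugate v σ τ → τ ≈ₘ τ′ → IsConjugate v σ τ′
conjugate-resp {v} c eq a = trans (cong (v ++_) (sym (eq a))) (c a)

conjugate-refl : (σ : Morphism) → IsConjugate [] σ σ
conjugate-refl σ a = sym (++-identityʳ (σ a))

conjugate-word : ∀ {v σ τ} → IsConjugate v σ τ → (w : Word) → v ++ apply τ w ≡ apply σ w ++ v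
conjugate-word {v} c [] = ++-identityʳ v
conjugate-word {v} {σ} {τ} c (a ∷ w) = begin
  v ++ (τ a ++ apply τ w)  ≡⟨ sym (++-assoc v (τ a) _) ⟩
  (v ++ τ a) ++ apply τ w  ≡⟨ cong (_++ apply τ w) (c a) ⟩
  (σ a ++ v) ++ apply τ w  ≡⟨ ++-assoc (σ a) v _ ⟩
  σ a ++ (v ++ apply τ w)  ≡⟨ cong (σ a ++_) (conjugate-word c w) ⟩
  σ a ++ (apply σ w ++ v)  ≡⟨ sym (++-assoc (σ a) _ v) ⟩
  (σ a ++ apply σ w) ++ v  ∎

conjugate-∘ : ∀ {v σ σ′ p γ γ′} → IsConjugate v σ σ′ → IsConjugate p γ γ′ →
  IsConjugate (apply σ p ++ v) (σ ∘ₘ γ) (σ′ ∘ₘ γ′)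
conjugate-∘ {v} {σ} {σ′} {p} {γ} {γ′} cσ cγ a = begin
  (apply σ p ++ v) ++ apply σ′ (γ′ a)  ≡⟨ ++-assoc (apply σ p) v _ ⟩
  apply σ p ++ (v ++ apply σ′ (γ′ a))  ≡⟨ cong (apply σ p ++_) (conjugate-word cσ (γ′ a)) ⟩
  apply σ p ++ (apply σ (γ′ a) ++ v)   ≡⟨ sym (++-assoc (apply σ p) _ v) ⟩
  (apply σ p ++ apply σ (γ′ a)) ++ v   ≡⟨ cong (_++ v) (sym (apply-++ σ p (γ′ a))) ⟩
  apply σ (p ++ γ′ a) ++ v             ≡⟨ cong (λ t → apply σ t ++ v) (cγ a) ⟩
  apply σ (γ a ++ p) ++ v              ≡⟨ cong (_++ v) (apply-++ σ (γ a) p) ⟩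
  (apply σ (γ a) ++ apply σ p) ++ v    ≡⟨ ++-assoc (apply σ (γ a)) _ v ⟩
  apply σ (γ a) ++ (apply σ p ++ v)    ∎

conjugate-relabel : ∀ {v σ τ} (θ η : Morphism) → IsConjugate v σ τ →
  IsConjugate (apply θ v) (θ ∘ₘ (σ ∘ₘ η)) (θ ∘ₘ (τ ∘ₘ η))
conjugate-relabel {v} {σ} {τ} θ η c =
  subst (λ w → IsConjugate w (θ ∘ₘ (σ ∘ₘ η)) (θ ∘ₘ (τ ∘ₘ η))) (++-identityʳ (apply θ v))
    (conjugate-∘ {σ = θ} {γ = σ ∘ₘ η} (conjugate-refl θ) (conjugate-∘ {σ = σ} {γ = η} c (conjugate-refl η)))

conjugate-reverse : ∀ {u γ Ψ} → IsConjugate u γ Ψ → IsConjugate (reverse u) (reversal Ψ) (reversal γ)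
conjugate-reverse {u} {γ} {Ψ} c a = begin
  reverse u ++ reverse (γ a)  ≡⟨ sym (reverse-++ (γ a) u) ⟩
  reverse (γ a ++ u)          ≡⟨ cong reverse (sym (c a)) ⟩
  reverse (u ++ Ψ a)          ≡⟨ reverse-++ u (Ψ a) ⟩
  reverse (Ψ a) ++ reverse u  ∎

conjugate-cancel : ∀ {z v σ ρ τ} → IsConjugate (z ++ v) σ τ → IsConjugate v ρ τ → IsConjugate z σ ρ
conjugate-cancel {z} {v} {σ} {ρ} {τ} czv cv a = ++-cancelʳ v (z ++ ρ a) (σ a ++ z) (begin
  (z ++ ρ a) ++ v  ≡⟨ ++-assoc z (ρ a) v ⟩
  z ++ (ρ a ++ v)  ≡⟨ cong (z ++_) (sym (cv a)) ⟩
  z ++ (v ++ τ a)  ≡⟨ sym (++-assoc z v (τ a)) ⟩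
  (z ++ v) ++ τ a  ≡⟨ czv a ⟩
  σ a ++ (z ++ v)  ≡⟨ sym (++-assoc (σ a) z v) ⟩
  (σ a ++ z) ++ v  ∎)


SelfConjugate : Word → Morphism → Set
SelfConjugate p σ = IsConjugate p σ (reversal σ)

ZeroShift : Morphism → Set
ZeroShift ψ = SelfConjugate (𝟎 ∷ []) ψ

zeroShift-ψ₁ : ZeroShift ψ₁
zeroShift-ψ₁ 𝟎 = refl
zeroShift-ψ₁ 𝟏 = refl

zeroShift-ψ₃ : ZeroShift ψ₃
zeroShift-ψ₃ 𝟎 = refl
zeroShift-ψ₃ 𝟏 = refl

opposite : Letter → Letter
opposite 𝟎 = 𝟏
opposite 𝟏 = 𝟎

record Standard (γ : Morphism) : Set where
  constructor mkStandard
  field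
    u z : Word
    x : Letter
    image-0 : γ 𝟎 ≡ u ∷ʳ x
    image-1 : γ 𝟏 ≡ z ∷ʳ opposite x
    self-conjugate : SelfConjugate (z ++ reverse u) γ

-- Applying ψ with ψ(a) 0 = 0 ψ̃(a) to a standard γ keeps a self-conjugator,
-- namely ψ(z ũ) 0 = ψ(z) 0 (ψ(u))~.
standard-step-conjugator : ∀ {ψ γ} → ZeroShift ψ → (S : Standard γ) → let open Standard S in
  SelfConjugate (apply ψ z ++ 𝟎 ∷ reverse (apply ψ u)) (ψ ∘ₘ γ)
standard-step-conjugator {ψ} {γ} zψ (mkStandard u z _ _ _ pal) =
  subst (λ p → SelfConjugate p (ψ ∘ₘ γ)) conjugator
    (conjugate-resp {σ = ψ ∘ₘ γ} (conjugate-∘ {σ = ψ} {γ = γ} zψ pal) (λ a → sym (reversal-∘ ψ γ a)))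
  where
  conjugator : apply ψ (z ++ reverse u) ++ 𝟎 ∷ [] ≡ apply ψ z ++ 𝟎 ∷ reverse (apply ψ u)
  conjugator = begin
    apply ψ (z ++ reverse u) ++ 𝟎 ∷ []                ≡⟨ cong (_++ 𝟎 ∷ []) (apply-++ ψ z (reverse u)) ⟩
    (apply ψ z ++ apply ψ (reverse u)) ++ 𝟎 ∷ []      ≡⟨ ++-assoc (apply ψ z) _ _ ⟩
    apply ψ z ++ (apply ψ (reverse u) ++ 𝟎 ∷ [])      ≡⟨ cong (apply ψ z ++_) (sym (conjugate-word zψ (reverse u))) ⟩
    apply ψ z ++ 𝟎 ∷ apply (reversal ψ) (reverse u)   ≡⟨ cong (λ t → apply ψ z ++ 𝟎 ∷ t) (sym (reverse-apply ψ u)) ⟩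
    apply ψ z ++ 𝟎 ∷ reverse (apply ψ u)              ∎

standard-step-01 : ∀ {ψ γ} → ZeroShift ψ → (S : Standard γ) →
  ψ (Standard.x S) ≡ 𝟎 ∷ 𝟏 ∷ [] → ψ (opposite (Standard.x S)) ≡ 𝟎 ∷ [] → Standard (ψ ∘ₘ γ)
standard-step-01 {ψ} {γ} zψ S@(mkStandard u z x e0 e1 _) ψx ψx̄ = mkStandard
  (apply ψ u ∷ʳ 𝟎) (apply ψ z) 𝟏
  (begin
    apply ψ (γ 𝟎)             ≡⟨ cong (apply ψ) e0 ⟩
    apply ψ (u ∷ʳ x)          ≡⟨ apply-snoc ψ u x ⟩
    apply ψ u ++ ψ x          ≡⟨ cong (apply ψ u ++_) ψx ⟩
    apply ψ u ++ 𝟎 ∷ 𝟏 ∷ []   ≡⟨ sym (∷ʳ-++ (apply ψ u) 𝟎 (𝟏 ∷ [])) ⟩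
    apply ψ u ∷ʳ 𝟎 ∷ʳ 𝟏       ∎)
  (trans (cong (apply ψ) e1) (trans (apply-snoc ψ z (opposite x)) (cong (apply ψ z ++_) ψx̄)))
  (subst (λ p → SelfConjugate p (ψ ∘ₘ γ))
    (cong (apply ψ z ++_) (sym (reverse-++ (apply ψ u) (𝟎 ∷ []))))
    (standard-step-conjugator zψ S))

standard-step-10 : ∀ {ψ γ} → ZeroShift ψ → (S : Standard γ) →
  ψ (Standard.x S) ≡ 𝟎 ∷ [] → ψ (opposite (Standard.x S)) ≡ 𝟎 ∷ 𝟏 ∷ [] → Standard (ψ ∘ₘ γ)
standard-step-10 {ψ} {γ} zψ S@(mkStandard u z x e0 e1 _) ψx ψx̄ = mkStandard
  (apply ψ u) (apply ψ z ∷ʳ 𝟎) 𝟎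
  (trans (cong (apply ψ) e0) (trans (apply-snoc ψ u x) (cong (apply ψ u ++_) ψx)))
  (begin
    apply ψ (γ 𝟏)              ≡⟨ cong (apply ψ) e1 ⟩
    apply ψ (z ∷ʳ opposite x)  ≡⟨ apply-snoc ψ z (opposite x) ⟩
    apply ψ z ++ ψ (opposite x) ≡⟨ cong (apply ψ z ++_) ψx̄ ⟩
    apply ψ z ++ 𝟎 ∷ 𝟏 ∷ []    ≡⟨ sym (∷ʳ-++ (apply ψ z) 𝟎 (𝟏 ∷ [])) ⟩
    apply ψ z ∷ʳ 𝟎 ∷ʳ 𝟏        ∎)
  (subst (λ p → SelfConjugate p (ψ ∘ₘ γ))
    (sym (∷ʳ-++ (apply ψ z) 𝟎 (reverse (apply ψ u))))
    (standard-step-conjugator zψ S))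

-- Every element of M_{1,3} is standard; ψ₁ and ψ₃ each map one of the two
-- final letters to 01 and the other to 0.
standard : (gs : List Gen13) → Standard (eval13 gs)
standard [] = mkStandard [] [] 𝟎 refl refl (λ { 𝟎 → refl ; 𝟏 → refl })
standard (g ∷ gs) = step g (standard gs)
  where
  step : (g : Gen13) → Standard (eval13 gs) → Standard (gen13 g ∘ₘ eval13 gs)
  step g1 S@(mkStandard _ _ 𝟎 _ _ _) = standard-step-01 zeroShift-ψ₁ S refl refl
  step g1 S@(mkStandard _ _ 𝟏 _ _ _) = standard-step-10 zeroShift-ψ₁ S refl refl
  step g3 S@(mkStandard _ _ 𝟎 _ _ _) = standard-step-10 zeroShift-ψ₃ S refl refl
  step g3 S@(mkStandard _ _ 𝟏 _ _ _) = standard-step-01 zeroShift-ψ₃ S refl refl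


-- σ* = E ∘ σ̃ ∘ E, the morphism Ψ_{EγE} is expected to be (Ψ_γ)*.
mirror : Morphism → Morphism
mirror σ = E ∘ₘ (reversal σ ∘ₘ E)

mirror-cong : ∀ {σ τ} → σ ≈ₘ τ → mirror σ ≈ₘ mirror τ
mirror-cong eq 𝟎 = cong (λ w → apply E (reverse w ++ [])) (eq 𝟏)
mirror-cong eq 𝟏 = cong (λ w → apply E (reverse w ++ [])) (eq 𝟎)

apply-mirror : (σ : Morphism) (w : Word) → apply (mirror σ) w ≡ apply E (apply (reversal σ) (apply E w))
apply-mirror σ w = trans (apply-∘ E (reversal σ ∘ₘ E) w) (cong (apply E) (apply-∘ (reversal σ) E w))

mirror-∘ : (σ τ : Morphism) → mirror (σ ∘ₘ τ) ≈ₘ (mirror σ ∘ₘ mirror τ)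
mirror-∘ σ τ a = begin
  apply E (apply (reversal (σ ∘ₘ τ)) (E a))                          ≡⟨ cong (apply E) (concatMap-cong (reversal-∘ σ τ) (E a)) ⟩
  apply E (apply (reversal σ ∘ₘ reversal τ) (E a))                   ≡⟨ cong (apply E) (apply-∘ (reversal σ) (reversal τ) (E a)) ⟩
  apply E (apply (reversal σ) (τ̃E))                                  ≡⟨ cong (λ w → apply E (apply (reversal σ) w)) (sym (E-involutive τ̃E)) ⟩
  apply E (apply (reversal σ) (apply E (apply E τ̃E)))                ≡⟨ sym (apply-mirror σ (apply E τ̃E)) ⟩
  apply (mirror σ) (mirror τ a)                                      ∎
  where
  τ̃E : Word
  τ̃E = apply (reversal τ) (E a)

mirror-gen38 : (i : Gen38) → mirror (gen38 i) ≈ₘ gen38 (star i)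
mirror-gen38 i3 𝟎 = refl
mirror-gen38 i3 𝟏 = refl
mirror-gen38 i8 𝟎 = refl
mirror-gen38 i8 𝟏 = refl

mirror-eval38 : (is : List Gen38) → mirror (eval38 is) ≈ₘ eval38 (map star is)
mirror-eval38 [] 𝟎 = refl
mirror-eval38 [] 𝟏 = refl
mirror-eval38 (i ∷ is) a = begin
  mirror (gen38 i ∘ₘ eval38 is) a                 ≡⟨ mirror-∘ (gen38 i) (eval38 is) a ⟩
  apply (mirror (gen38 i)) (mirror (eval38 is) a) ≡⟨ cong (apply (mirror (gen38 i))) (mirror-eval38 is a) ⟩
  apply (mirror (gen38 i)) (eval38 (map star is) a) ≡⟨ concatMap-cong (mirror-gen38 i) (eval38 (map star is) a) ⟩
  apply (gen38 (star i)) (eval38 (map star is) a) ∎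


proposition5 : (gs : List Gen13) (u : Word) → eval13 gs 𝟎 ≡ u ++ (𝟎 ∷ []) →
    (Ψγ : Morphism) → IsConjugate u (eval13 gs) Ψγ →
    Σ Word λ u′ → Σ Morphism λ Φ →
      ((E ∘ₘ (eval13 gs ∘ₘ E)) 𝟎 ≡ u′ ++ (𝟎 ∷ []))
      × IsConjugate u′ (E ∘ₘ (eval13 gs ∘ₘ E)) Φ
      × (Φ ≈ₘ (E ∘ₘ (reversal Ψγ ∘ₘ E)))
      × ((is : List Gen38) → Ψγ ≈ₘ eval38 is → Φ ≈ₘ eval38 (map star is))
proposition5 gs u γ0 Ψ conj-u with standard gs
... | mkStandard u₀ z x e0 e1 pal with ∷ʳ-injective u u₀ (trans (sym γ0) e0)
... | refl , refl =
  apply E z , mirror Ψ , image-0 , conj-Ez , (λ _ → refl) ,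
  (λ is Ψ≈ a → trans (mirror-cong Ψ≈ a) (mirror-eval38 is a))
  where
  -- γ(0) = u 0 forces γ(1) = z 1, hence EγE(0) = E(z) 0.
  image-0 : apply E (eval13 gs 𝟏 ++ []) ≡ apply E z ++ 𝟎 ∷ []
  image-0 = trans (cong (apply E) (trans (++-identityʳ _) e1)) (apply-snoc E z 𝟏)
  -- ũ conjugates Ψ̃ to γ̃; cancelling it from z ũ, z conjugates γ to Ψ̃.
  conj-z : IsConjugate z (eval13 gs) (reversal Ψ)
  conj-z = conjugate-cancel {v = reverse u} {τ = reversal (eval13 gs)} pal
    (conjugate-reverse {γ = eval13 gs} {Ψ = Ψ} conj-u)
  conj-Ez : IsConjugate (apply E z) (E ∘ₘ (eval13 gs ∘ₘ E)) (mirror Ψ)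
  conj-Ez = conjugate-relabel {σ = eval13 gs} {τ = reversal Ψ} E E conj-z
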